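{- Let $G_1=(V_1,E_1)$ be a graph with $G_1=EI(\mathcal{H}_1)$ for some 3-uniform hypergraph $\mathcal{H}_1=(V_1,\mathcal{E}_1)$, let $v\in V_1$ with $d_{G_1}(v)\ge 2$, and let $T=(V_2,E_2)$ be a tree with $n\ge 2$ vertices such that $V_1\cap V_2=\{v\}$. Then the 1-fusion $G_1\oplus T=(V_1\cup V_2,\,E_1\cup E_2)$ is the edge intersection hypergraph of some 3-uniform hypergraph.
   Context: All graphs and hypergraphs are finite, may have isolated vertices, and have no loops or multiple edges. A hypergraph is 3-uniform if every hyperedge has exactly 3 vertices. The edge intersection hypergraph of $\mathcal{H}=(V,\mathcal{E})$ is $EI(\mathcal{H})=(V,\mathcal{E}^{EI})$ with $\mathcal{E}^{EI}=\{e_1\cap e_2 : e_1,e_2\in\mathcal{E},\ e_1\neq e_2,\ |e_1\cap e_2|\ge 2\}$; it has the same vertex set as $\mathcal{H}$, and when it is 2-uniform it is regarded as a simple graph; "$G=EI(\mathcal{H})$" means equality of vertex sets and edge sets. For two graphs sharing exactly one vertex, their 1-fusion $G_1\oplus T$ is simply their union (vertex sets and edge sets united). $d_{G_1}(v)$ denotes the degree of $v$ in $G_1$. -}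

module Defs where

open import Data.Nat using (ℕ; _≤_)
open import Data.Fin using (Fin)
open import Data.Fin.Subset using (Subset; _∈_; _⊆_; _∩_; _∪_; ⁅_⁆; ∣_∣)
open import Data.List using (List; length; _++_; take)
open import Data.List.Relation.Unary.Linked using (Linked)
open import Data.List.Relation.Unary.Unique.Propositional using (Unique)
open import Data.Product using (Σ; ∃; _×_)
open import Data.Sum using (_⊎_)
open import Relation.Binary.PropositionalEquality using (_≡_; _≢_)
open import Relation.Nullary using (¬_)
open import Function.Bundles using (_⇔_)

-- A vertex set is a
-- Subset N; a set of (hyper)edges is a predicate on Subset N (automatically
-- a finite family, since Subset N is finite).  Set equality of vertex subsets
-- is ≡; equality of edge sets is pointwise logical equivalence.

EdgeSet : ℕ → Set₁
EdgeSet N = Subset N → Set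

IsGraph : ∀ {N} → Subset N → EdgeSet N → Set
IsGraph V E = ∀ e → E e → (e ⊆ V) × (∣ e ∣ ≡ 2)

IsHypergraph : ∀ {N} → Subset N → EdgeSet N → Set
IsHypergraph V 𝓔 = ∀ e → 𝓔 e → e ⊆ V

Is3Uniform : ∀ {N} → EdgeSet N → Set
Is3Uniform 𝓔 = ∀ e → 𝓔 e → ∣ e ∣ ≡ 3

EIEdges : ∀ {N} → EdgeSet N → EdgeSet N
EIEdges 𝓔 e = Σ _ λ e₁ → Σ _ λ e₂ →
  𝓔 e₁ × 𝓔 e₂ × e₁ ≢ e₂ × e ≡ e₁ ∩ e₂ × 2 ≤ ∣ e ∣

IsEIOf : ∀ {N} → (V : Subset N) (E : EdgeSet N) → (VH : Subset N) (𝓔 : EdgeSet N) → Set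
IsEIOf V E VH 𝓔 = (V ≡ VH) × (∀ e → E e ⇔ EIEdges 𝓔 e)

IsEI3 : ∀ {N} → Subset N → EdgeSet N → Set₁
IsEI3 {N} V E = Σ (EdgeSet N) λ 𝓔 →
  IsHypergraph V 𝓔 × Is3Uniform 𝓔 × IsEIOf V E V 𝓔

Adj : ∀ {N} → EdgeSet N → Fin N → Fin N → Set
Adj E x y = E (⁅ x ⁆ ∪ ⁅ y ⁆)

Deg≥2 : ∀ {N} → EdgeSet N → Fin N → Set
Deg≥2 E v = Σ _ λ u → Σ _ λ w → u ≢ w × Adj E v u × Adj E v w

data Walk {N} (E : EdgeSet N) : Fin N → Fin N → Set where
  here : ∀ {x} → Walk E x x
  step : ∀ {x y z} → Adj E x y → Walk E y z → Walk E x z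

Connected : ∀ {N} → Subset N → EdgeSet N → Set
Connected V E = ∀ x y → x ∈ V → y ∈ V → Walk E x y

IsCycle : ∀ {N} → EdgeSet N → List (Fin N) → Set
IsCycle E xs = (3 ≤ length xs) × Unique xs × Linked (Adj E) (xs ++ take 1 xs)

Acyclic : ∀ {N} → EdgeSet N → Set
Acyclic E = ∀ xs → ¬ IsCycle E xs

IsTree : ∀ {N} → Subset N → EdgeSet N → Set
IsTree V E = IsGraph V E × Connected V E × Acyclic E

fuseV : ∀ {N} → Subset N → Subset N → Subset N
fuseV V₁ V₂ = V₁ ∪ V₂

fuseE : ∀ {N} → EdgeSet N → EdgeSet N → EdgeSet N
fuseE E₁ E₂ e = E₁ e ⊎ E₂ e

-- Keep the hyperedges of 𝓗₁ and add the triples {a, m, b} for the paths a – m – b of T, the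
-- triples {v, p, u} for the tree neighbours p of v, and {a, b, w} for every leaf a ≠ v
-- of T whose neighbour b has degree at most 2, where u ≠ w are G₁-neighbours of v.
-- Every tree edge then lies in two new triples with different third vertices, hence is
-- an intersection. Conversely two distinct triples meet in at most a pair. A new triple
-- meets V₁ at most in {v, u} or {v, w}, which are edges of G₁; and two distinct new
-- triples meet in a tree edge, in {v, u} or {v, w}, or in a pair lying in only one new
-- triple: for {x, y} with a common tree neighbour because T has no 4-cycle, for {p, u}
-- because u only occurs with v, and for {p, w} by the degree condition on the pendants.
module Submission where

open import Defs
open import Data.Nat using (ℕ; suc; _≤_; z≤n; s≤s)
open import Data.Nat.Properties using (≤-reflexive; <⇒≱)
open import Data.Fin using (Fin; zero; suc; _≟_)
open import Data.Fin.Properties using (any?; suc-injective)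
open import Data.Fin.Subset using (Subset; inside; outside; _∈_; _∉_; _⊆_; _∪_; _∩_; ⁅_⁆; ∣_∣)
open import Data.Fin.Subset.Properties
  using (_∈?_; x∈⁅x⁆; x∈⁅y⁆⇒x≡y; ∣⁅x⁆∣≡1; x∈p∪q⁻; p⊆p∪q; q⊆p∪q; x∈p∩q⁺; x∈p∩q⁻; ⊆-antisym; p⊂q⇒∣p∣<∣q∣; ∪-assoc; ∪-comm; ∪-idem; ∪-identityˡ; ∩-comm)
open import Data.Vec using (_∷_; here; there)
open import Data.List using (List; []; _∷_; _++_)
open import Data.List.Relation.Unary.Linked using (Linked; [-]; _∷_)
open import Data.List.Relation.Unary.AllPairs using ([]; _∷_)
open import Data.List.Relation.Unary.All using ([]; _∷_)
open import Data.List.Relation.Unary.All.Properties using (¬Any⇒All¬)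
open import Data.List.Relation.Unary.Any using (here; there)
open import Data.List.Membership.Propositional using () renaming (_∈_ to _∈ₗ_)
open import Data.List.Relation.Unary.Unique.Propositional using (Unique)
open import Data.Product using (∃; ∃₂; _×_; _,_; proj₁; proj₂)
open import Data.Sum using (_⊎_; inj₁; inj₂; [_,_]′; map₂)
open import Data.Empty using (⊥; ⊥-elim)
open import Function using (_∘_)
open import Function.Bundles using (_⇔_; mk⇔; Equivalence)
open import Relation.Binary.PropositionalEquality
open import Relation.Nullary using (¬_; Dec; yes; no)
open import Relation.Nullary.Decidable using (_×-dec_; ¬?; decidable-stable)

private variable
  n : ℕ
  a b c d p x y z : Fin n
  t : Subset n

pair : Fin n → Fin n → Subset n
pair a b = ⁅ a ⁆ ∪ ⁅ b ⁆

triple : Fin n → Fin n → Fin n → Subset n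
triple a b c = ⁅ a ⁆ ∪ pair b c

∈-pair⁻ : x ∈ pair a b → x ≡ a ⊎ x ≡ b
∈-pair⁻ {a = a} {b} x∈ with x∈p∪q⁻ ⁅ a ⁆ ⁅ b ⁆ x∈
... | inj₁ x∈a = inj₁ (x∈⁅y⁆⇒x≡y a x∈a)
... | inj₂ x∈b = inj₂ (x∈⁅y⁆⇒x≡y b x∈b)

∈-pair⁺ : x ≡ a ⊎ x ≡ b → x ∈ pair a b
∈-pair⁺ {b = b} (inj₁ refl) = p⊆p∪q ⁅ b ⁆ (x∈⁅x⁆ _)
∈-pair⁺ {a = a} (inj₂ refl) = q⊆p∪q ⁅ a ⁆ _ (x∈⁅x⁆ _)

∈-triple⁻ : x ∈ triple a b c → x ≡ a ⊎ x ≡ b ⊎ x ≡ c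
∈-triple⁻ {a = a} {b} {c} x∈ with x∈p∪q⁻ ⁅ a ⁆ (pair b c) x∈
... | inj₁ x∈a  = inj₁ (x∈⁅y⁆⇒x≡y a x∈a)
... | inj₂ x∈bc = inj₂ (∈-pair⁻ x∈bc)

∈-triple⁺ : x ≡ a ⊎ x ≡ b ⊎ x ≡ c → x ∈ triple a b c
∈-triple⁺ {b = b} {c} (inj₁ refl) = p⊆p∪q (pair b c) (x∈⁅x⁆ _)
∈-triple⁺ {a = a}     (inj₂ x∈bc) = q⊆p∪q ⁅ a ⁆ _ (∈-pair⁺ x∈bc)

∈-triple-≢ : x ∈ triple a b c → x ≢ c → x ≡ a ⊎ x ≡ b
∈-triple-≢ x∈ x≢c with ∈-triple⁻ x∈
... | inj₁ x≡a        = inj₁ x≡a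
... | inj₂ (inj₁ x≡b) = inj₂ x≡b
... | inj₂ (inj₂ x≡c) = ⊥-elim (x≢c x≡c)

triple⊆ : ∀ {p : Subset n} → a ∈ p → b ∈ p → c ∈ p → triple a b c ⊆ p
triple⊆ a∈ b∈ c∈ x∈ with ∈-triple⁻ x∈
... | inj₁ refl        = a∈
... | inj₂ (inj₁ refl) = b∈
... | inj₂ (inj₂ refl) = c∈

pair-comm : ∀ (a b : Fin n) → pair a b ≡ pair b a
pair-comm a b = ∪-comm ⁅ a ⁆ ⁅ b ⁆

triple-swap₁₂ : ∀ (a b c : Fin n) → triple a b c ≡ triple b a c
triple-swap₁₂ a b c = begin
  ⁅ a ⁆ ∪ ⁅ b ⁆ ∪ ⁅ c ⁆    ≡⟨ ∪-assoc ⁅ a ⁆ ⁅ b ⁆ ⁅ c ⁆ ⟨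
  (⁅ a ⁆ ∪ ⁅ b ⁆) ∪ ⁅ c ⁆  ≡⟨ cong (_∪ ⁅ c ⁆) (pair-comm a b) ⟩
  (⁅ b ⁆ ∪ ⁅ a ⁆) ∪ ⁅ c ⁆  ≡⟨ ∪-assoc ⁅ b ⁆ ⁅ a ⁆ ⁅ c ⁆ ⟩
  ⁅ b ⁆ ∪ ⁅ a ⁆ ∪ ⁅ c ⁆    ∎
  where open ≡-Reasoning

triple-swap₂₃ : ∀ (a b c : Fin n) → triple a b c ≡ triple a c b
triple-swap₂₃ a b c = cong (⁅ a ⁆ ∪_) (pair-comm b c)

triple-reverse : ∀ (a b c : Fin n) → triple a b c ≡ triple c b a
triple-reverse a b c = begin
  triple a b c  ≡⟨ triple-swap₁₂ a b c ⟩
  triple b a c  ≡⟨ triple-swap₂₃ b a c ⟩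
  triple b c a  ≡⟨ triple-swap₁₂ b c a ⟩
  triple c b a  ∎
  where open ≡-Reasoning

∣⁅x⁆∪p∣≡1+∣p∣ : ∀ {x : Fin n} {p} → x ∉ p → ∣ ⁅ x ⁆ ∪ p ∣ ≡ suc ∣ p ∣
∣⁅x⁆∪p∣≡1+∣p∣ {x = zero}  {outside ∷ p} _  = cong suc (cong ∣_∣ (∪-identityˡ p))
∣⁅x⁆∪p∣≡1+∣p∣ {x = zero}  {inside ∷ p}  x∉ = ⊥-elim (x∉ here)
∣⁅x⁆∪p∣≡1+∣p∣ {x = suc x} {outside ∷ p} x∉ = ∣⁅x⁆∪p∣≡1+∣p∣ (x∉ ∘ there)
∣⁅x⁆∪p∣≡1+∣p∣ {x = suc x} {inside ∷ p}  x∉ = cong suc (∣⁅x⁆∪p∣≡1+∣p∣ (x∉ ∘ there))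

∣pair∣≡2 : a ≢ b → ∣ pair a b ∣ ≡ 2
∣pair∣≡2 {a = a} {b} a≢b = begin
  ∣ pair a b ∣     ≡⟨ ∣⁅x⁆∪p∣≡1+∣p∣ (a≢b ∘ x∈⁅y⁆⇒x≡y b) ⟩
  suc ∣ ⁅ b ⁆ ∣    ≡⟨ cong suc (∣⁅x⁆∣≡1 b) ⟩
  2                ∎
  where open ≡-Reasoning

∣triple∣≡3 : a ≢ b → a ≢ c → b ≢ c → ∣ triple a b c ∣ ≡ 3
∣triple∣≡3 {a = a} {b = b} {c = c} a≢b a≢c b≢c = begin
  ∣ triple a b c ∣   ≡⟨ ∣⁅x⁆∪p∣≡1+∣p∣ (λ a∈ → [ a≢b , a≢c ]′ (∈-pair⁻ a∈)) ⟩
  suc ∣ pair b c ∣   ≡⟨ cong suc (∣pair∣≡2 b≢c) ⟩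
  3                  ∎
  where open ≡-Reasoning

⊆∧∣∣≥⇒≡ : ∀ {p q : Subset n} → p ⊆ q → ∣ q ∣ ≤ ∣ p ∣ → p ≡ q
⊆∧∣∣≥⇒≡ {p = p} {q} p⊆q ∣q∣≤∣p∣ = ⊆-antisym p⊆q q⊆p
  where
  q⊆p : q ⊆ p
  q⊆p {x} x∈q with x ∈? p
  ... | yes x∈p = x∈p
  ... | no  x∉p = ⊥-elim (<⇒≱ (p⊂q⇒∣p∣<∣q∣ (p⊆q , x , x∈q , x∉p)) ∣q∣≤∣p∣)

member : ∀ (p : Subset n) → 1 ≤ ∣ p ∣ → ∃ (_∈ p)
member (inside  ∷ p) _     = zero , here
member (outside ∷ p) 1≤∣p∣ with member p 1≤∣p∣
... | x , x∈p = suc x , there x∈p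

two-members : ∀ (p : Subset n) → 2 ≤ ∣ p ∣ → ∃₂ λ x y → x ≢ y × x ∈ p × y ∈ p
two-members (inside ∷ p) (s≤s 1≤∣p∣) with member p 1≤∣p∣
... | y , y∈p = zero , suc y , (λ ()) , here , there y∈p
two-members (outside ∷ p) 2≤∣p∣ with two-members p 2≤∣p∣
... | x , y , x≢y , x∈p , y∈p = suc x , suc y , x≢y ∘ suc-injective , there x∈p , there y∈p

∣p∣≡2⇒pair : ∀ {p : Subset n} → ∣ p ∣ ≡ 2 → ∃₂ λ x y → x ≢ y × p ≡ pair x y
∣p∣≡2⇒pair {p = p} ∣p∣≡2 with two-members p (≤-reflexive (sym ∣p∣≡2))
... | x , y , x≢y , x∈p , y∈p =
  x , y , x≢y , sym (⊆∧∣∣≥⇒≡ xy⊆p (≤-reflexive (trans ∣p∣≡2 (sym (∣pair∣≡2 x≢y)))))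
  where
  xy⊆p : pair x y ⊆ p
  xy⊆p z∈ with ∈-pair⁻ z∈
  ... | inj₁ refl = x∈p
  ... | inj₂ refl = y∈p

∩-of-3-sets≡pair : ∀ {e₁ e₂ : Subset n} → ∣ e₁ ∣ ≡ 3 → ∣ e₂ ∣ ≡ 3 → e₁ ≢ e₂ →
              x ≢ y → x ∈ e₁ ∩ e₂ → y ∈ e₁ ∩ e₂ → e₁ ∩ e₂ ≡ pair x y
∩-of-3-sets≡pair {x = x} {y = y} {e₁ = e₁} {e₂ = e₂} ∣e₁∣≡3 ∣e₂∣≡3 e₁≢e₂ x≢y x∈ y∈ = ⊆-antisym ⊆xy xy⊆
  where
  x∈₁ = proj₁ (x∈p∩q⁻ e₁ e₂ x∈); x∈₂ = proj₂ (x∈p∩q⁻ e₁ e₂ x∈)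
  y∈₁ = proj₁ (x∈p∩q⁻ e₁ e₂ y∈); y∈₂ = proj₂ (x∈p∩q⁻ e₁ e₂ y∈)
  ⊆xy : e₁ ∩ e₂ ⊆ pair x y
  ⊆xy {z} z∈ with z ≟ x | z ≟ y
  ... | yes z≡x | _       = ∈-pair⁺ (inj₁ z≡x)
  ... | no  _   | yes z≡y = ∈-pair⁺ (inj₂ z≡y)
  ... | no  z≢x | no  z≢y = ⊥-elim (e₁≢e₂ (trans (sym (xyz≡ ∣e₁∣≡3 x∈₁ y∈₁ z∈₁)) (xyz≡ ∣e₂∣≡3 x∈₂ y∈₂ z∈₂)))
    where
    z∈₁ = proj₁ (x∈p∩q⁻ e₁ e₂ z∈); z∈₂ = proj₂ (x∈p∩q⁻ e₁ e₂ z∈)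
    xyz≡ : ∀ {e} → ∣ e ∣ ≡ 3 → x ∈ e → y ∈ e → z ∈ e → triple x y z ≡ e
    xyz≡ ∣e∣≡3 x∈e y∈e z∈e = ⊆∧∣∣≥⇒≡ (triple⊆ x∈e y∈e z∈e)
      (≤-reflexive (trans ∣e∣≡3 (sym (∣triple∣≡3 x≢y (z≢x ∘ sym) (z≢y ∘ sym)))))
  xy⊆ : pair x y ⊆ e₁ ∩ e₂
  xy⊆ z∈ with ∈-pair⁻ z∈
  ... | inj₁ refl = x∈
  ... | inj₂ refl = y∈

∩-of-3-sets-is-pair : ∀ {e₁ e₂ : Subset n} → ∣ e₁ ∣ ≡ 3 → ∣ e₂ ∣ ≡ 3 → e₁ ≢ e₂ → 2 ≤ ∣ e₁ ∩ e₂ ∣ →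
                      ∃₂ λ x y → x ≢ y × x ∈ e₁ ∩ e₂ × y ∈ e₁ ∩ e₂ × e₁ ∩ e₂ ≡ pair x y
∩-of-3-sets-is-pair {e₁ = e₁} {e₂ = e₂} ∣e₁∣≡3 ∣e₂∣≡3 e₁≢e₂ 2≤ with two-members (e₁ ∩ e₂) 2≤
... | x , y , x≢y , x∈ , y∈ = x , y , x≢y , x∈ , y∈ , ∩-of-3-sets≡pair ∣e₁∣≡3 ∣e₂∣≡3 e₁≢e₂ x≢y x∈ y∈

triple-∩-triple : c ≢ a → c ≢ b → c ≢ d → triple a b c ∩ triple a b d ≡ pair a b
triple-∩-triple {c = c} {a = a} {b = b} {d = d} c≢a c≢b c≢d = ⊆-antisym ⊆ab ab⊆
  where
  ⊆ab : triple a b c ∩ triple a b d ⊆ pair a b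
  ⊆ab z∈ with x∈p∩q⁻ (triple a b c) _ z∈
  ... | z∈abc , z∈abd with ∈-triple⁻ z∈abc | ∈-triple⁻ z∈abd
  ... | inj₁ z≡a        | _                = ∈-pair⁺ (inj₁ z≡a)
  ... | inj₂ (inj₁ z≡b) | _                = ∈-pair⁺ (inj₂ z≡b)
  ... | inj₂ (inj₂ refl) | inj₁ c≡a        = ⊥-elim (c≢a c≡a)
  ... | inj₂ (inj₂ refl) | inj₂ (inj₁ c≡b) = ⊥-elim (c≢b c≡b)
  ... | inj₂ (inj₂ refl) | inj₂ (inj₂ c≡d) = ⊥-elim (c≢d c≡d)
  ab⊆ : pair a b ⊆ triple a b c ∩ triple a b d
  ab⊆ z∈ with ∈-pair⁻ z∈
  ... | inj₁ z≡a = x∈p∩q⁺ (∈-triple⁺ (inj₁ z≡a) , ∈-triple⁺ (inj₁ z≡a))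
  ... | inj₂ z≡b = x∈p∩q⁺ (∈-triple⁺ (inj₂ (inj₁ z≡b)) , ∈-triple⁺ (inj₂ (inj₁ z≡b)))

triple≢triple : c ≢ a → c ≢ b → c ≢ d → triple a b c ≢ triple a b d
triple≢triple {c = c} c≢a c≢b c≢d abc≡abd
  with ∈-triple⁻ (subst (c ∈_) abc≡abd (∈-triple⁺ (inj₂ (inj₂ refl))))
... | inj₁ c≡a        = c≢a c≡a
... | inj₂ (inj₁ c≡b) = c≢b c≡b
... | inj₂ (inj₂ c≡d) = c≢d c≡d

Adj-sym : ∀ (E : EdgeSet n) → Adj E x y → Adj E y x
Adj-sym {x = x} {y = y} E = subst E (pair-comm x y)

Walk-preserves : ∀ {E : EdgeSet n} (S : Fin n → Set) →
                 (∀ {p q} → S p → Adj E p q → S q) → Walk E x y → S x → S y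
Walk-preserves S closed here       Sx = Sx
Walk-preserves S closed (step e w) Sx = Walk-preserves S closed w (closed Sx e)

module GraphProperties {V : Subset n} {E : EdgeSet n} (graph : IsGraph V E) where

  Adj⇒∈ˡ : Adj E x y → x ∈ V
  Adj⇒∈ˡ xy = proj₁ (graph _ xy) (∈-pair⁺ (inj₁ refl))

  Adj⇒∈ʳ : Adj E x y → y ∈ V
  Adj⇒∈ʳ xy = proj₁ (graph _ xy) (∈-pair⁺ (inj₂ refl))

  Adj⇒≢ : Adj E x y → x ≢ y
  Adj⇒≢ {x = x} xx refl with trans (sym (∣⁅x⁆∣≡1 x)) (trans (cong ∣_∣ (sym (∪-idem ⁅ x ⁆))) (proj₂ (graph _ xx)))
  ... | ()

  edge⇒Adj : ∀ {e} → E e → ∃₂ λ x y → Adj E x y × e ≡ pair x y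
  edge⇒Adj {e} e∈E with ∣p∣≡2⇒pair {p = e} (proj₂ (graph e e∈E))
  ... | x , y , _ , refl = x , y , e∈E , refl

module TreeProperties {n : ℕ} {V : Subset n} {E : EdgeSet n} (tree : IsTree V E) where

  open GraphProperties (proj₁ tree) public
  open import Data.List.Membership.DecPropositional (_≟_ {n}) using () renaming (_∈?_ to _∈ₗ?_)

  private
    connected = proj₁ (proj₂ tree)
    acyclic   = proj₂ (proj₂ tree)

  data Path : Fin n → Fin n → List (Fin n) → Set where
    [_] : ∀ x → Path x x (x ∷ [])
    _∷_ : ∀ {x y z ys} → Adj E x y → Path y z (y ∷ ys) → Path x z (x ∷ y ∷ ys)

  SimplePath : Fin n → Fin n → Set
  SimplePath x z = ∃ λ ys → Path x z (x ∷ ys) × Unique (x ∷ ys)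

  suffix-from : ∀ {xs} → x ∈ₗ xs → Path y z xs → Unique xs → SimplePath x z
  suffix-from (here refl) [ _ ]      u       = [] , [ _ ] , u
  suffix-from (here refl) (e ∷ p)    u       = _ , e ∷ p , u
  suffix-from (there x∈)  (_ ∷ p)    (_ ∷ u) = suffix-from x∈ p u

  Walk⇒SimplePath : Walk E x z → SimplePath x z
  Walk⇒SimplePath here = [] , [ _ ] , [] ∷ []
  Walk⇒SimplePath {x = x} (step e w) with Walk⇒SimplePath w
  ... | ys , p , u with x ∈ₗ? (_ ∷ ys)
  ...   | yes x∈ = suffix-from x∈ p u
  ...   | no  x∉ = _ , e ∷ p , ¬Any⇒All¬ _ x∉ ∷ u

  Path+edge⇒Linked : ∀ {xs t} → Path x z xs → Adj E z t → Linked (Adj E) (xs ++ t ∷ [])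
  Path+edge⇒Linked [ _ ]   zt = zt ∷ [-]
  Path+edge⇒Linked (e ∷ p) zt = e ∷ Path+edge⇒Linked p zt

  Adj? : ∀ x y → Dec (Adj E x y)
  Adj? x y with x ∈? V | y ∈? V
  ... | no x∉ | _     = no (x∉ ∘ Adj⇒∈ˡ)
  ... | yes _ | no y∉ = no (y∉ ∘ Adj⇒∈ʳ)
  ... | yes x∈ | yes y∈ with Walk⇒SimplePath (connected x y x∈ y∈)
  ... | []        , [ _ ]       , _ = no λ xx → Adj⇒≢ xx refl
  ... | _ ∷ []    , e ∷ [ _ ]   , _ = yes e
  ... | _ ∷ _ ∷ _ , p@(_ ∷ _ ∷ _) , u =
        no λ xy → acyclic _ (s≤s (s≤s (s≤s z≤n)) , u , Path+edge⇒Linked p (Adj-sym E xy))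

  no-triangle : Adj E x y → Adj E y z → Adj E z x → ⊥
  no-triangle xy yz zx = acyclic (_ ∷ _ ∷ _ ∷ [])
    ( s≤s (s≤s (s≤s z≤n))
    , ((Adj⇒≢ xy ∷ Adj⇒≢ (Adj-sym E zx) ∷ []) ∷ (Adj⇒≢ yz ∷ []) ∷ [] ∷ [])
    , xy ∷ yz ∷ zx ∷ [-] )

  no-square : ∀ {m m′} → x ≢ y → m ≢ m′ → Adj E x m → Adj E m y → Adj E y m′ → Adj E m′ x → ⊥
  no-square x≢y m≢m′ xm my ym′ m′x = acyclic (_ ∷ _ ∷ _ ∷ _ ∷ [])
    ( s≤s (s≤s (s≤s z≤n))
    , ((Adj⇒≢ xm ∷ x≢y ∷ Adj⇒≢ (Adj-sym E m′x) ∷ []) ∷ (Adj⇒≢ my ∷ m≢m′ ∷ []) ∷ (Adj⇒≢ ym′ ∷ []) ∷ [] ∷ [])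
    , xm ∷ my ∷ ym′ ∷ m′x ∷ [-] )

  closed⇒⊇ : (S : Fin n → Set) → (∀ {p q} → S p → Adj E p q → S q) →
             S x → x ∈ V → y ∈ V → S y
  closed⇒⊇ S closed Sx x∈ y∈ = Walk-preserves S closed (connected _ _ x∈ y∈) Sx

module Construction
  {N : ℕ} {V₁ V₂ : Subset N} {E₁ E₂ 𝓔₁ : EdgeSet N} {v u w : Fin N}
  (graph₁ : IsGraph V₁ E₁) (hypergraph₁ : IsHypergraph V₁ 𝓔₁) (uniform₁ : Is3Uniform 𝓔₁)
  (EI₁ : ∀ e → E₁ e ⇔ EIEdges 𝓔₁ e)
  (u≢w : u ≢ w) (vu : Adj E₁ v u) (vw : Adj E₁ v w)
  (tree : IsTree V₂ E₂) (V₁∩V₂≡v : V₁ ∩ V₂ ≡ ⁅ v ⁆)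
  where

  open GraphProperties graph₁ using () renaming (Adj⇒∈ʳ to Adj₁⇒∈ʳ; Adj⇒≢ to Adj₁⇒≢)
  open TreeProperties tree

  infix 4 _~_
  _~_ : Fin N → Fin N → Set
  x ~ y = Adj E₂ x y

  ~-sym : x ~ y → y ~ x
  ~-sym = Adj-sym E₂

  v∈V₂ : v ∈ V₂
  v∈V₂ = proj₂ (x∈p∩q⁻ V₁ V₂ (subst (v ∈_) (sym V₁∩V₂≡v) (x∈⁅x⁆ v)))

  ∈V₁∩V₂⇒≡v : x ∈ V₁ → x ∈ V₂ → x ≡ v
  ∈V₁∩V₂⇒≡v {x} x∈V₁ x∈V₂ = x∈⁅y⁆⇒x≡y v (subst (x ∈_) V₁∩V₂≡v (x∈p∩q⁺ (x∈V₁ , x∈V₂)))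

  u∉V₂ : u ∉ V₂
  u∉V₂ u∈V₂ = Adj₁⇒≢ vu (sym (∈V₁∩V₂⇒≡v (Adj₁⇒∈ʳ vu) u∈V₂))

  w∉V₂ : w ∉ V₂
  w∉V₂ w∈V₂ = Adj₁⇒≢ vw (sym (∈V₁∩V₂⇒≡v (Adj₁⇒∈ʳ vw) w∈V₂))

  ∈V₂⇒≢u : x ∈ V₂ → x ≢ u
  ∈V₂⇒≢u x∈V₂ refl = u∉V₂ x∈V₂

  ∈V₂⇒≢w : x ∈ V₂ → x ≢ w
  ∈V₂⇒≢w x∈V₂ refl = w∉V₂ x∈V₂

  record Pendant (a b : Fin N) : Set where
    field
      edge  : a ~ b
      ≢v    : a ≢ v
      leaf  : ∀ {c} → a ~ c → c ≡ b
      deg≤2 : ∀ {c d} → b ~ c → b ~ d → c ≢ a → d ≢ a → c ≡ d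
  open Pendant

  data New (e : Subset N) : Set where
    path    : ∀ {a m b} → a ~ m → m ~ b → a ≢ b → e ≡ triple a m b → New e
    spoke   : v ~ p → e ≡ triple v p u → New e
    pendant : Pendant a b → e ≡ triple a b w → New e

  𝓔 : EdgeSet N
  𝓔 e = 𝓔₁ e ⊎ New e

  New-vertex : New t → y ∈ t →
               y ∈ V₂
             ⊎ (y ≡ u × ∃ λ p → v ~ p × t ≡ triple v p u)
             ⊎ (y ≡ w × ∃₂ λ a b → Pendant a b × t ≡ triple a b w)
  New-vertex (path am mb _ refl) y∈ = inj₁ (triple⊆ (Adj⇒∈ˡ am) (Adj⇒∈ˡ mb) (Adj⇒∈ʳ mb) y∈)
  New-vertex (spoke vp refl) y∈ with ∈-triple⁻ y∈
  ... | inj₁ refl        = inj₁ v∈V₂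
  ... | inj₂ (inj₁ refl) = inj₁ (Adj⇒∈ʳ vp)
  ... | inj₂ (inj₂ refl) = inj₂ (inj₁ (refl , _ , vp , refl))
  New-vertex (pendant P refl) y∈ with ∈-triple⁻ y∈
  ... | inj₁ refl        = inj₁ (Adj⇒∈ˡ (edge P))
  ... | inj₂ (inj₁ refl) = inj₁ (Adj⇒∈ʳ (edge P))
  ... | inj₂ (inj₂ refl) = inj₂ (inj₂ (refl , _ , _ , P , refl))

  New∋u : New t → u ∈ t → ∃ λ p → v ~ p × t ≡ triple v p u
  New∋u new u∈ with New-vertex new u∈
  ... | inj₁ u∈V₂                   = ⊥-elim (u∉V₂ u∈V₂)
  ... | inj₂ (inj₁ (_ , through-u)) = through-u
  ... | inj₂ (inj₂ (u≡w , _))       = ⊥-elim (u≢w u≡w)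

  New∋w : New t → w ∈ t → ∃₂ λ a b → Pendant a b × t ≡ triple a b w
  New∋w new w∈ with New-vertex new w∈
  ... | inj₁ w∈V₂                   = ⊥-elim (w∉V₂ w∈V₂)
  ... | inj₂ (inj₁ (w≡u , _))       = ⊥-elim (u≢w (sym w≡u))
  ... | inj₂ (inj₂ (_ , through-w)) = through-w

  𝓔-hypergraph : IsHypergraph (V₁ ∪ V₂) 𝓔
  𝓔-hypergraph e (inj₁ old) x∈ = p⊆p∪q V₂ (hypergraph₁ e old x∈)
  𝓔-hypergraph e (inj₂ new) x∈ with New-vertex new x∈
  ... | inj₁ x∈V₂                = q⊆p∪q V₁ V₂ x∈V₂
  ... | inj₂ (inj₁ (refl , _))   = p⊆p∪q V₂ (Adj₁⇒∈ʳ vu)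
  ... | inj₂ (inj₂ (refl , _))   = p⊆p∪q V₂ (Adj₁⇒∈ʳ vw)

  𝓔-uniform : Is3Uniform 𝓔
  𝓔-uniform e (inj₁ old) = uniform₁ e old
  𝓔-uniform e (inj₂ (path am mb a≢b refl)) = ∣triple∣≡3 (Adj⇒≢ am) a≢b (Adj⇒≢ mb)
  𝓔-uniform e (inj₂ (spoke vp refl)) =
    ∣triple∣≡3 (Adj⇒≢ vp) (∈V₂⇒≢u v∈V₂) (∈V₂⇒≢u (Adj⇒∈ʳ vp))
  𝓔-uniform e (inj₂ (pendant P refl)) =
    ∣triple∣≡3 (Adj⇒≢ (edge P)) (∈V₂⇒≢w (Adj⇒∈ˡ (edge P))) (∈V₂⇒≢w (Adj⇒∈ʳ (edge P)))

  pendant-unique : ∀ {a′ b′} → Pendant a b → Pendant a′ b′ →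
                   p ≡ a ⊎ p ≡ b → p ≡ a′ ⊎ p ≡ b′ → p ≢ v → triple a b w ≡ triple a′ b′ w
  pendant-unique P P′ (inj₁ refl) (inj₁ refl) _ rewrite leaf P (edge P′) = refl
  pendant-unique P P′ (inj₁ refl) (inj₂ refl) _ rewrite leaf P (~-sym (edge P′)) = triple-swap₁₂ _ _ w
  pendant-unique P P′ (inj₂ refl) (inj₁ refl) _ rewrite leaf P′ (~-sym (edge P)) = triple-swap₁₂ _ _ w
  pendant-unique {a = a} {b = b} {a′ = a′} P P′ (inj₂ refl) (inj₂ refl) b≢v with a ≟ a′
  ... | yes refl = refl
  ... | no  a≢a′ = ⊥-elim (v∉ (closed⇒⊇ S closed (inj₁ refl) (Adj⇒∈ˡ (edge P)) v∈V₂))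
    where
    -- two leaves on a vertex of degree 2 would form a component of T without v
    S : Fin N → Set
    S z = z ≡ a ⊎ z ≡ b ⊎ z ≡ a′
    closed : ∀ {q r} → S q → q ~ r → S r
    closed (inj₁ refl)        qr = inj₂ (inj₁ (leaf P qr))
    closed (inj₂ (inj₂ refl)) qr = inj₂ (inj₁ (leaf P′ qr))
    closed {r = r} (inj₂ (inj₁ refl)) qr with r ≟ a
    ... | yes r≡a = inj₁ r≡a
    ... | no  r≢a = inj₂ (inj₂ (deg≤2 P qr (~-sym (edge P′)) r≢a (≢-sym a≢a′)))
    v∉ : ¬ S v
    v∉ (inj₁ v≡a)        = ≢v P (sym v≡a)
    v∉ (inj₂ (inj₁ v≡b)) = b≢v (sym v≡b)
    v∉ (inj₂ (inj₂ v≡a′)) = ≢v P′ (sym v≡a′)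

  UniqueNewThrough : Fin N → Fin N → Subset N → Set
  UniqueNewThrough x y t = ∀ {t′} → New t′ → x ∈ t′ → y ∈ t′ → t′ ≡ t

  unique-spoke-through : p ∈ V₂ → p ≢ v → UniqueNewThrough p u (triple v p u)
  unique-spoke-through p∈V₂ p≢v new p∈ u∈ with New∋u new u∈
  ... | _ , _ , refl with ∈-triple-≢ p∈ (∈V₂⇒≢u p∈V₂)
  ...   | inj₁ p≡v  = ⊥-elim (p≢v p≡v)
  ...   | inj₂ refl = refl

  pendant-∈V₂ : Pendant a b → p ≡ a ⊎ p ≡ b → p ∈ V₂
  pendant-∈V₂ P (inj₁ refl) = Adj⇒∈ˡ (edge P)
  pendant-∈V₂ P (inj₂ refl) = Adj⇒∈ʳ (edge P)

  unique-pendant-through : Pendant a b → p ≡ a ⊎ p ≡ b → p ≢ v → UniqueNewThrough p w (triple a b w)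
  unique-pendant-through P p∈ab p≢v new p∈ w∈ with New∋w new w∈
  ... | _ , _ , P′ , refl = pendant-unique P′ P (∈-triple-≢ p∈ (∈V₂⇒≢w (pendant-∈V₂ P p∈ab))) p∈ab p≢v

  edge-pair-adjacent : a ~ b → x ≡ a ⊎ x ≡ b → y ≡ a ⊎ y ≡ b → x ≢ y → x ~ y
  edge-pair-adjacent ab (inj₁ refl) (inj₁ refl) x≢y = ⊥-elim (x≢y refl)
  edge-pair-adjacent ab (inj₁ refl) (inj₂ refl) _   = ab
  edge-pair-adjacent ab (inj₂ refl) (inj₁ refl) _   = ~-sym ab
  edge-pair-adjacent ab (inj₂ refl) (inj₂ refl) x≢y = ⊥-elim (x≢y refl)

  New-through-V₂-pair : x ∈ V₂ → y ∈ V₂ → x ≢ y → ¬ x ~ y → New t → x ∈ t → y ∈ t →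
                        ∃ λ m → x ~ m × m ~ y × t ≡ triple x m y
  New-through-V₂-pair _ _ x≢y ¬xy (path {a} {m} {b} am mb _ refl) x∈ y∈
    with ∈-triple⁻ x∈ | ∈-triple⁻ y∈
  ... | inj₁ refl        | inj₂ (inj₂ refl) = m , am , mb , refl
  ... | inj₂ (inj₂ refl) | inj₁ refl        = m , ~-sym mb , ~-sym am , triple-reverse a m b
  ... | inj₁ refl        | inj₁ refl        = ⊥-elim (x≢y refl)
  ... | inj₁ refl        | inj₂ (inj₁ refl) = ⊥-elim (¬xy am)
  ... | inj₂ (inj₁ refl) | inj₁ refl        = ⊥-elim (¬xy (~-sym am))
  ... | inj₂ (inj₁ refl) | inj₂ (inj₁ refl) = ⊥-elim (x≢y refl)
  ... | inj₂ (inj₁ refl) | inj₂ (inj₂ refl) = ⊥-elim (¬xy mb)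
  ... | inj₂ (inj₂ refl) | inj₂ (inj₁ refl) = ⊥-elim (¬xy (~-sym mb))
  ... | inj₂ (inj₂ refl) | inj₂ (inj₂ refl) = ⊥-elim (x≢y refl)
  New-through-V₂-pair x∈V₂ y∈V₂ x≢y ¬xy (spoke vp refl) x∈ y∈ =
    ⊥-elim (¬xy (edge-pair-adjacent vp (∈-triple-≢ x∈ (∈V₂⇒≢u x∈V₂)) (∈-triple-≢ y∈ (∈V₂⇒≢u y∈V₂)) x≢y))
  New-through-V₂-pair x∈V₂ y∈V₂ x≢y ¬xy (pendant P refl) x∈ y∈ =
    ⊥-elim (¬xy (edge-pair-adjacent (edge P) (∈-triple-≢ x∈ (∈V₂⇒≢w x∈V₂)) (∈-triple-≢ y∈ (∈V₂⇒≢w y∈V₂)) x≢y))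

  unique-path-through : x ∈ V₂ → y ∈ V₂ → x ≢ y → ¬ x ~ y → New t → x ∈ t → y ∈ t →
                        UniqueNewThrough x y t
  unique-path-through x∈V₂ y∈V₂ x≢y ¬xy new x∈ y∈ new′ x∈′ y∈′
    with New-through-V₂-pair x∈V₂ y∈V₂ x≢y ¬xy new  x∈  y∈
       | New-through-V₂-pair x∈V₂ y∈V₂ x≢y ¬xy new′ x∈′ y∈′
  ... | m , xm , my , refl | m′ , xm′ , m′y , refl with m ≟ m′
  ...   | yes refl = refl
  ...   | no  m≢m′ = ⊥-elim (no-square x≢y m≢m′ xm my (~-sym m′y) (~-sym xm′))

  pair-leaving-V₂ : New t → x ∈ t → y ∈ t → x ≢ y → y ∉ V₂ →
                    Adj E₁ x y ⊎ (x ∈ V₂ × x ≢ v × UniqueNewThrough x y t)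
  pair-leaving-V₂ new x∈ y∈ x≢y y∉V₂ with New-vertex new y∈
  ... | inj₁ y∈V₂ = ⊥-elim (y∉V₂ y∈V₂)
  ... | inj₂ (inj₁ (refl , p , vp , refl)) with ∈-triple-≢ x∈ x≢y
  ...   | inj₁ refl = inj₁ vu
  ...   | inj₂ refl = inj₂ (Adj⇒∈ʳ vp , ≢-sym (Adj⇒≢ vp) , unique-spoke-through (Adj⇒∈ʳ vp) (≢-sym (Adj⇒≢ vp)))
  pair-leaving-V₂ {x = x} new x∈ y∈ x≢y y∉V₂ | inj₂ (inj₂ (refl , a , b , P , refl)) with x ≟ v
  ... | yes refl = inj₁ vw
  ... | no  x≢v  = inj₂ (pendant-∈V₂ P x∈ab , x≢v , unique-pendant-through P x∈ab x≢v)
    where x∈ab = ∈-triple-≢ x∈ x≢y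

  classify : New t → x ∈ t → y ∈ t → x ≢ y → ¬ x ~ y → Adj E₁ x y ⊎ UniqueNewThrough x y t
  classify {x = x} {y = y} new x∈ y∈ x≢y ¬xy with x ∈? V₂ | y ∈? V₂
  ... | yes x∈V₂ | yes y∈V₂ = inj₂ (unique-path-through x∈V₂ y∈V₂ x≢y ¬xy new x∈ y∈)
  ... | _        | no  y∉V₂ = map₂ (proj₂ ∘ proj₂) (pair-leaving-V₂ new x∈ y∈ x≢y y∉V₂)
  ... | no  x∉V₂ | yes _    with pair-leaving-V₂ new y∈ x∈ (≢-sym x≢y) x∉V₂
  ...   | inj₁ yx                  = inj₁ (Adj-sym E₁ yx)
  ...   | inj₂ (_ , _ , unique-yx) = inj₂ λ new′ x∈′ y∈′ → unique-yx new′ y∈′ x∈′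

  New-pair-in-V₁ : New t → x ∈ t → y ∈ t → x ≢ y → x ∈ V₁ → y ∈ V₁ → Adj E₁ x y
  New-pair-in-V₁ {x = x} {y = y} new x∈ y∈ x≢y x∈V₁ y∈V₁ with x ∈? V₂ | y ∈? V₂
  ... | yes x∈V₂ | yes y∈V₂ = ⊥-elim (x≢y (trans (∈V₁∩V₂⇒≡v x∈V₁ x∈V₂) (sym (∈V₁∩V₂⇒≡v y∈V₁ y∈V₂))))
  ... | _        | no  y∉V₂ with pair-leaving-V₂ new x∈ y∈ x≢y y∉V₂
  ...   | inj₁ xy                 = xy
  ...   | inj₂ (x∈V₂ , x≢v , _)   = ⊥-elim (x≢v (∈V₁∩V₂⇒≡v x∈V₁ x∈V₂))
  New-pair-in-V₁ new x∈ y∈ x≢y x∈V₁ y∈V₁ | no x∉V₂ | yes _ with pair-leaving-V₂ new y∈ x∈ (≢-sym x≢y) x∉V₂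
  ...   | inj₁ yx                 = Adj-sym E₁ yx
  ...   | inj₂ (y∈V₂ , y≢v , _)   = ⊥-elim (y≢v (∈V₁∩V₂⇒≡v y∈V₁ y∈V₂))

  New-meets : 𝓔 t → ∀ {t′} → New t′ → t ≢ t′ → 2 ≤ ∣ t ∩ t′ ∣ → fuseE E₁ E₂ (t ∩ t′)
  New-meets {t = t} ∈𝓔 {t′} new′ t≢t′ 2≤
    with ∩-of-3-sets-is-pair (𝓔-uniform t ∈𝓔) (𝓔-uniform t′ (inj₂ new′)) t≢t′ 2≤
  ... | x , y , x≢y , x∈ , y∈ , t∩t′≡xy = subst (fuseE E₁ E₂) (sym t∩t′≡xy) (meeting ∈𝓔)
    where
    x∈t = proj₁ (x∈p∩q⁻ t t′ x∈); x∈t′ = proj₂ (x∈p∩q⁻ t t′ x∈)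
    y∈t = proj₁ (x∈p∩q⁻ t t′ y∈); y∈t′ = proj₂ (x∈p∩q⁻ t t′ y∈)
    meeting : 𝓔 t → Adj E₁ x y ⊎ x ~ y
    meeting (inj₁ old) = inj₁ (New-pair-in-V₁ new′ x∈t′ y∈t′ x≢y (hypergraph₁ t old x∈t) (hypergraph₁ t old y∈t))
    meeting (inj₂ new) with Adj? x y
    ... | yes xy  = inj₂ xy
    ... | no  ¬xy with classify new′ x∈t′ y∈t′ x≢y ¬xy
    ...   | inj₁ xy     = inj₁ xy
    ...   | inj₂ unique = ⊥-elim (t≢t′ (unique new x∈t y∈t))

  EI⇒edge : ∀ e → EIEdges 𝓔 e → fuseE E₁ E₂ e
  EI⇒edge e (t₁ , t₂ , inj₁ old₁ , inj₁ old₂ , rest) = inj₁ (Equivalence.from (EI₁ e) (t₁ , t₂ , old₁ , old₂ , rest))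
  EI⇒edge e (t₁ , t₂ , ∈𝓔₁ , inj₂ new₂ , t₁≢t₂ , refl , 2≤) = New-meets ∈𝓔₁ new₂ t₁≢t₂ 2≤
  EI⇒edge e (t₁ , t₂ , inj₂ new₁ , inj₁ old₂ , t₁≢t₂ , refl , 2≤) =
    subst (fuseE E₁ E₂) (∩-comm t₂ t₁) (New-meets (inj₁ old₂) new₁ (≢-sym t₁≢t₂) (subst (λ s → 2 ≤ ∣ s ∣) (∩-comm t₁ t₂) 2≤))

  sole-neighbour : ¬ ∃ (λ c → x ~ c × c ≢ y) → x ~ c → c ≡ y
  sole-neighbour {y = y} {c = c} no-other xc = decidable-stable (c ≟ y) λ c≢y → no-other (c , xc , c≢y)

  Cover : Fin N → Fin N → Fin N → Set
  Cover a b c = c ≢ a × c ≢ b × 𝓔 (triple a b c)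

  two-covers⇒EI : ∀ {d} → a ≢ b → Cover a b c → Cover a b d → c ≢ d → EIEdges 𝓔 (pair a b)
  two-covers⇒EI a≢b (c≢a , c≢b , abc) (_ , _ , abd) c≢d =
    _ , _ , abc , abd , triple≢triple c≢a c≢b c≢d , sym (triple-∩-triple c≢a c≢b c≢d) ,
    ≤-reflexive (sym (∣pair∣≡2 a≢b))

  Cover-sym : Cover a b c → Cover b a c
  Cover-sym {a = a} {b = b} {c = c} (c≢a , c≢b , abc) = c≢b , c≢a , subst 𝓔 (triple-swap₁₂ a b c) abc

  neighbour-cover : a ~ b → a ~ c → c ≢ b → Cover a b c
  neighbour-cover {a = a} {b = b} {c = c} ab ac c≢b =
    ≢-sym (Adj⇒≢ ac) , c≢b , inj₂ (path (~-sym ac) ab c≢b (sym (trans (triple-swap₁₂ c a b) (triple-swap₂₃ a c b))))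

  spoke-cover : v ~ b → Cover v b u
  spoke-cover vb = ≢-sym (∈V₂⇒≢u v∈V₂) , ≢-sym (∈V₂⇒≢u (Adj⇒∈ʳ vb)) , inj₂ (spoke vb refl)

  pendant-cover : Pendant a b → Cover a b w
  pendant-cover P = ≢-sym (∈V₂⇒≢w (Adj⇒∈ˡ (edge P))) , ≢-sym (∈V₂⇒≢w (Adj⇒∈ʳ (edge P))) , inj₂ (pendant P refl)

  isolated-edge-EI : a ~ b → (∀ {c} → a ~ c → c ≡ b) → (∀ {c} → b ~ c → c ≡ a) → EIEdges 𝓔 (pair a b)
  isolated-edge-EI {a = a} {b = b} ab a-leaf b-leaf
    with closed⇒⊇ (λ z → z ≡ a ⊎ z ≡ b) closed (inj₁ refl) (Adj⇒∈ˡ ab) v∈V₂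
    where
    closed : ∀ {q r} → q ≡ a ⊎ q ≡ b → q ~ r → r ≡ a ⊎ r ≡ b
    closed (inj₁ refl) qr = inj₂ (a-leaf qr)
    closed (inj₂ refl) qr = inj₁ (b-leaf qr)
  ... | inj₁ refl = two-covers⇒EI (Adj⇒≢ ab) (spoke-cover ab) (Cover-sym (pendant-cover P)) u≢w
    where
    P : Pendant b a
    P = record { edge = ~-sym ab ; ≢v = ≢-sym (Adj⇒≢ ab) ; leaf = b-leaf
               ; deg≤2 = λ ac _ c≢b _ → ⊥-elim (c≢b (a-leaf ac)) }
  ... | inj₂ refl = two-covers⇒EI (Adj⇒≢ ab) (Cover-sym (spoke-cover (~-sym ab))) (pendant-cover P) u≢w
    where
    P : Pendant a b
    P = record { edge = ab ; ≢v = Adj⇒≢ ab ; leaf = a-leaf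
               ; deg≤2 = λ bc _ c≢a _ → ⊥-elim (c≢a (b-leaf bc)) }

  cover-from : a ~ b → a ~ c → c ≢ b → EIEdges 𝓔 (pair a b)
  cover-from {a = a} {b = b} {c = c} ab ac c≢b
    with Adj⇒≢ ab | neighbour-cover ab ac c≢b | any? (λ d → Adj? a d ×-dec ¬? (d ≟ b) ×-dec ¬? (d ≟ c))
  ... | a≢b | c-cover | yes (d , ad , d≢b , d≢c) = two-covers⇒EI a≢b c-cover (neighbour-cover ab ad d≢b) (≢-sym d≢c)
  ... | a≢b | c-cover | no no-third with any? (λ d → Adj? b d ×-dec ¬? (d ≟ a))
  ...   | yes (d , bd , d≢a) = two-covers⇒EI a≢b c-cover (Cover-sym (neighbour-cover (~-sym ab) bd d≢a)) c≢d
    where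
    c≢d : c ≢ d
    c≢d refl = no-triangle ab bd (~-sym ac)
  ...   | no b-not-branching with v ≟ a | v ≟ b
  ...     | yes refl | _        = two-covers⇒EI a≢b c-cover (spoke-cover ab) (∈V₂⇒≢u (Adj⇒∈ʳ ac))
  ...     | no _     | yes refl = two-covers⇒EI a≢b c-cover (Cover-sym (spoke-cover (~-sym ab))) (∈V₂⇒≢u (Adj⇒∈ʳ ac))
  ...     | no _     | no v≢b   = two-covers⇒EI a≢b c-cover (Cover-sym (pendant-cover P)) (∈V₂⇒≢w (Adj⇒∈ʳ ac))
    where
    only-c : ∀ {d} → a ~ d → d ≢ b → d ≡ c
    only-c {d} ad d≢b = decidable-stable (d ≟ c) λ d≢c → no-third (d , ad , d≢b , d≢c)
    P : Pendant b a
    P = record { edge = ~-sym ab ; ≢v = ≢-sym v≢b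
               ; leaf = sole-neighbour b-not-branching
               ; deg≤2 = λ ad ad′ d≢b d′≢b → trans (only-c ad d≢b) (sym (only-c ad′ d′≢b)) }

  cover : a ~ b → EIEdges 𝓔 (pair a b)
  cover {a = a} {b = b} ab with any? (λ c → Adj? a c ×-dec ¬? (c ≟ b))
  ... | yes (c , ac , c≢b) = cover-from ab ac c≢b
  ... | no a-leaf with any? (λ c → Adj? b c ×-dec ¬? (c ≟ a))
  ...   | yes (c , bc , c≢a) = subst (EIEdges 𝓔) (pair-comm b a) (cover-from (~-sym ab) bc c≢a)
  ...   | no b-leaf = isolated-edge-EI ab (sole-neighbour a-leaf) (sole-neighbour b-leaf)

  edge⇒EI : ∀ e → fuseE E₁ E₂ e → EIEdges 𝓔 e
  edge⇒EI e (inj₁ e∈E₁) with Equivalence.to (EI₁ e) e∈E₁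
  ... | t₁ , t₂ , old₁ , old₂ , rest = t₁ , t₂ , inj₁ old₁ , inj₁ old₂ , rest
  edge⇒EI e (inj₂ e∈E₂) with edge⇒Adj e∈E₂
  ... | _ , _ , ab , refl = cover ab

  fusion-is-EI3 : IsEI3 (fuseV V₁ V₂) (fuseE E₁ E₂)
  fusion-is-EI3 = 𝓔 , 𝓔-hypergraph , 𝓔-uniform , refl , λ e → mk⇔ (edge⇒EI e) (EI⇒edge e)

theorem4 : ∀ {N : ℕ} (V₁ : Subset N) (E₁ : EdgeSet N) (V₂ : Subset N) (E₂ : EdgeSet N) (v : Fin N) →
    IsGraph V₁ E₁ →
    IsEI3 V₁ E₁ →
    Deg≥2 E₁ v →
    IsTree V₂ E₂ →
    2 ≤ ∣ V₂ ∣ →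
    V₁ ∩ V₂ ≡ ⁅ v ⁆ →
    IsEI3 (fuseV V₁ V₂) (fuseE E₁ E₂)
theorem4 V₁ E₁ V₂ E₂ v graph₁ (𝓔₁ , hypergraph₁ , uniform₁ , _ , EI₁) (u , w , u≢w , vu , vw) tree _ V₁∩V₂≡v =
  Construction.fusion-is-EI3 graph₁ hypergraph₁ uniform₁ EI₁ u≢w vu vw tree V₁∩V₂≡v
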